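{- For every $n\geq 2$, $\kappa(BH_n;K_{1,2})=n$.
   Context: The $n$-dimensional balanced hypercube $BH_n$ is the graph with vertex set $\{0,1,2,3\}^n$, vertices written $(a_0,a_1,\dots,a_{n-1})$, in which $(a_0,\dots,a_{n-1})$ is adjacent exactly to the $2n$ vertices $((a_0\pm 1)\bmod 4,a_1,\dots,a_{n-1})$ and, for each $1\le i\le n-1$, $((a_0\pm1)\bmod 4,a_1,\dots,a_{i-1},(a_i+(-1)^{a_0})\bmod 4,a_{i+1},\dots,a_{n-1})$. For a connected graph $G$ and a set $F$ of connected subgraphs of $G$, let $V(F)$ be the union of their vertex sets; $F$ is a subgraph-cut if $G-V(F)$ is disconnected or trivial. For a connected subgraph $H$ of $G$, an $H$-structure-cut is a subgraph-cut each of whose elements is isomorphic to $H$, and $\kappa(G;H)$ is the minimum cardinality of an $H$-structure-cut. $K_{1,2}$ is the star with two leaves (a path on three vertices). -}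

module Defs where

open import Data.Nat using (ℕ; zero; suc; _≤_)
open import Data.Fin using (Fin; zero; suc)
open import Data.Vec using (Vec; _∷_; []; lookup; _[_]≔_)
open import Data.List using (List; length)
open import Data.List.Relation.Unary.Any using (Any)
open import Data.List.Relation.Unary.All using (All)
open import Data.List.Relation.Unary.AllPairs using (AllPairs)
open import Data.Product using (Σ; ∃; ∃-syntax; _×_; _,_)
open import Data.Sum using (_⊎_)
open import Data.Empty using (⊥)
open import Relation.Nullary using (¬_)
open import Relation.Binary.PropositionalEquality using (_≡_)

inc4 : Fin 4 → Fin 4
inc4 zero = suc zero
inc4 (suc zero) = suc (suc zero)
inc4 (suc (suc zero)) = suc (suc (suc zero))
inc4 (suc (suc (suc zero))) = zero

dec4 : Fin 4 → Fin 4
dec4 zero = suc (suc (suc zero))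
dec4 (suc zero) = zero
dec4 (suc (suc zero)) = suc zero
dec4 (suc (suc (suc zero))) = suc (suc zero)

-- x ↦ (x + (-1)^a) mod 4
shift : (a : Fin 4) → Fin 4 → Fin 4
shift zero = inc4
shift (suc zero) = dec4
shift (suc (suc zero)) = inc4
shift (suc (suc (suc zero))) = dec4

Vertex : ℕ → Set
Vertex n = Vec (Fin 4) n

-- Adjacency of the balanced hypercube BH_n
-- (a_0 ∷ xs) ~ (b_0 ∷ ys) iff b_0 = a_0 ± 1 (mod 4) and either ys = xs, or
-- ys is xs with the coordinate a_i (1 ≤ i ≤ n-1, here index i : Fin m) replaced
-- by a_i + (-1)^{a_0} (mod 4).
Adj : (n : ℕ) → Vertex n → Vertex n → Set
Adj zero _ _ = ⊥
Adj (suc m) (a ∷ xs) (b ∷ ys) =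
  (b ≡ inc4 a ⊎ b ≡ dec4 a) ×
  (ys ≡ xs ⊎ ∃[ i ] ys ≡ xs [ i ]≔ shift a (lookup xs i))

-- A subgraph of BH_n isomorphic to K_{1,2}: a centre and two distinct leaves,
-- both adjacent to the centre (vertex set {c, l1, l2}, edges c-l1, c-l2).
record Star (n : ℕ) : Set where
  constructor star
  field
    centre : Vertex n
    leaf1  : Vertex n
    leaf2  : Vertex n

IsK12 : (n : ℕ) → Star n → Set
IsK12 n (star c u w) = Adj n c u × Adj n c w × ¬ (u ≡ w) × ¬ (c ≡ u) × ¬ (c ≡ w)

-- Two stars denote the same subgraph (same centre, same unordered pair of leaves).
SameStar : {n : ℕ} → Star n → Star n → Set
SameStar (star c u w) (star c' u' w') =
  c ≡ c' × ((u ≡ u' × w ≡ w') ⊎ (u ≡ w' × w ≡ u'))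

InV : {n : ℕ} → List (Star n) → Vertex n → Set
InV F x = Any (λ s → x ≡ Star.centre s ⊎ x ≡ Star.leaf1 s ⊎ x ≡ Star.leaf2 s) F

data Reach {n : ℕ} (F : List (Star n)) : Vertex n → Vertex n → Set where
  here : ∀ {x} → ¬ InV F x → Reach F x x
  step : ∀ {x y z} → ¬ InV F x → Adj n x y → Reach F y z → Reach F x z

Disconnected : (n : ℕ) → List (Star n) → Set
Disconnected n F =
  ∃[ u ] ∃[ v ] (¬ InV F u × ¬ InV F v × ¬ Reach F u v)

Trivial : (n : ℕ) → List (Star n) → Set
Trivial n F = ∀ u v → ¬ InV F u → ¬ InV F v → u ≡ v

IsK12StructureCut : (n : ℕ) → List (Star n) → Set
IsK12StructureCut n F = All (IsK12 n) F × (Disconnected n F ⊎ Trivial n F)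

KappaK12 : (n k : ℕ) → Set
KappaK12 n k =
  (Σ (List (Star n)) λ F →
      IsK12StructureCut n F × AllPairs (λ s t → ¬ SameStar s t) F × length F ≡ k)
  × (∀ (F : List (Star n)) → IsK12StructureCut n F →
       AllPairs (λ s t → ¬ SameStar s t) F → k ≤ length F)

module Submission where

-- Upper bound (`Isolation`): for each of the n tails t ∈ {0, e₁, …, e_{n-1}} the
-- star centred at (2, t) with leaves (1, t), (3, t); together they contain all
-- 2n neighbours of o = (0,…,0) but not o, so they separate o.
--
-- Lower bound (`robust`, `cut-size`): by induction on M, removing from BH_{M+1}
-- a vertex set covered by at most M stars leaves a connected graph with an edge.
-- BH_{M+2} splits along a₁ into four copies of BH_{M+1}; stars restrict to
-- copies, so a copy met by at most M stars is connected by induction ("good"),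
-- and a copy met by all of them has an untouched antipodal copy.  A pigeonhole
-- count over disjoint families of short paths (`Pigeonhole`; each star blocks at
-- most two, twice as many exist) shows that every survivor reaches a good copy
-- (`Escape`, `Detour`) and that adjacent good copies are linked (`Link`).

open import Defs
open import Data.Bool using (Bool; true; false; not; _xor_)
import Data.Bool.Properties as Bool
open import Data.Empty using (⊥; ⊥-elim)
open import Data.Fin using (Fin; zero; suc)
open import Data.Fin.Properties using (all?; any?; ¬∀⟶∃¬; _≟_)
open import Data.List using (List; []; _∷_; length; tabulate)
open import Data.List.Properties using (length-tabulate)
open import Data.List.Relation.Unary.All using (All; []; _∷_)
import Data.List.Relation.Unary.All as All using (map; zipWith)
import Data.List.Relation.Unary.All.Properties as AllProps
open import Data.List.Relation.Unary.AllPairs using (AllPairs)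
import Data.List.Relation.Unary.AllPairs.Properties as AllPairs
open import Data.List.Relation.Unary.Any using (Any; here; there)
import Data.List.Relation.Unary.Any as Any using (any?)
import Data.List.Relation.Unary.Any.Properties as AnyProps
open import Data.Maybe using (Maybe; just; nothing)
import Data.Maybe as Maybe
open import Data.Maybe.Properties using (just-injective)
open import Data.Nat using (ℕ; zero; suc; _+_; _*_; _≤_; _<_; z≤n; s≤s; _≤?_)
open import Data.Nat.Properties
  using (≤-trans; ≤-refl; ≤-reflexive; ≤-pred; <-irrefl; ≤-<-trans; ≰⇒>; m≤m+n; m≤n+m; n≤1+n; m<m+n; n<1+n;
         +-mono-≤; +-monoʳ-≤; +-comm; +-identityʳ; *-comm; *-identityʳ; *-monoʳ-≤; *-monoʳ-<;
         +-commutativeSemigroup; module ≤-Reasoning)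
open import Data.Product using (∃; ∃-syntax; _×_; _,_; proj₁; proj₂)
open import Data.Sum using (_⊎_; inj₁; inj₂)
open import Data.Vec using (Vec; _∷_; []; lookup; _[_]≔_; replicate; head; tail)
open import Data.Vec.Properties using (≡-dec; []≔-idempotent; []≔-lookup; lookup∘update; lookup∘update′)
open import Function using (_∘_)
open import Relation.Nullary using (¬_; ¬?; Dec; yes; no)
open import Relation.Nullary.Decidable using (from-yes; _⊎-dec_; _×-dec_; _→-dec_)
open import Relation.Binary.PropositionalEquality
  using (_≡_; _≢_; refl; sym; trans; cong; cong₂; subst; subst₂; module ≡-Reasoning)


antipode : Fin 4 → Fin 4
antipode a = inc4 (inc4 a)

Neighbour₄ : Fin 4 → Fin 4 → Set
Neighbour₄ a b = b ≡ inc4 a ⊎ b ≡ dec4 a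

neighbour₄? : ∀ a b → Dec (Neighbour₄ a b)
neighbour₄? a b = (b ≟ inc4 a) ⊎-dec (b ≟ dec4 a)

-- The parities of a and b agree.  The shift x ↦ x + (-1)^a depends only on the
-- parity of a.
sameParity : Fin 4 → Fin 4 → Bool
sameParity a b = not (parity a xor parity b)
  where
  parity : Fin 4 → Bool
  parity zero = true
  parity (suc zero) = false
  parity (suc (suc zero)) = true
  parity (suc (suc (suc zero))) = false

inc-dec : ∀ a → inc4 (dec4 a) ≡ a
inc-dec = from-yes (all? λ a → inc4 (dec4 a) ≟ a)

dec-inc : ∀ a → dec4 (inc4 a) ≡ a
dec-inc = from-yes (all? λ a → dec4 (inc4 a) ≟ a)

dec-dec : ∀ a → dec4 (dec4 a) ≡ antipode a
dec-dec = from-yes (all? λ a → dec4 (dec4 a) ≟ antipode a)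

antipode-inc : ∀ a → antipode (inc4 a) ≡ dec4 a
antipode-inc = from-yes (all? λ a → antipode (inc4 a) ≟ dec4 a)

antipode≢ : ∀ a → antipode a ≢ a
antipode≢ = from-yes (all? λ a → ¬? (antipode a ≟ a))

neighbour-antipode : ∀ a b → Neighbour₄ a b → Neighbour₄ (antipode a) b
neighbour-antipode = from-yes (all? λ a → all? λ b → neighbour₄? a b →-dec neighbour₄? (antipode a) b)

classify₄ : ∀ j k → k ≡ j ⊎ k ≡ inc4 j ⊎ k ≡ dec4 j ⊎ k ≡ antipode j
classify₄ = from-yes (all? λ j → all? λ k →
  (k ≟ j) ⊎-dec (k ≟ inc4 j) ⊎-dec (k ≟ dec4 j) ⊎-dec (k ≟ antipode j))

shift≢ : ∀ a x → shift a x ≢ x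
shift≢ = from-yes (all? λ a → all? λ x → ¬? (shift a x ≟ x))

shift-antipode : ∀ a x → shift (antipode a) x ≡ shift a x
shift-antipode = from-yes (all? λ a → all? λ x → shift (antipode a) x ≟ shift a x)

shift-inverse : ∀ a b → Neighbour₄ a b → ∀ x → shift b (shift a x) ≡ x
shift-inverse = from-yes (all? λ a → all? λ b → neighbour₄? a b →-dec all? λ x → shift b (shift a x) ≟ x)

shift-sameParity : ∀ a b → sameParity a b ≡ true → ∀ x → shift b x ≡ shift a x
shift-sameParity = from-yes (all? λ a → all? λ b →
  (sameParity a b Bool.≟ true) →-dec all? λ x → shift b x ≟ shift a x)

shift-oppParity : ∀ a b → sameParity a b ≡ false → ∀ x → shift b x ≡ shift (inc4 a) x
shift-oppParity = from-yes (all? λ a → all? λ b →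
  (sameParity a b Bool.≟ false) →-dec all? λ x → shift b x ≟ shift (inc4 a) x)

sameParity-flip : ∀ a b c → Neighbour₄ b c → sameParity a c ≡ not (sameParity a b)
sameParity-flip = from-yes (all? λ a → all? λ b → all? λ c →
  neighbour₄? b c →-dec (sameParity a c Bool.≟ not (sameParity a b)))

sameParity-refl : ∀ a → sameParity a a ≡ true
sameParity-refl = from-yes (all? λ a → sameParity a a Bool.≟ true)

sameParity-inc : ∀ a → sameParity a (inc4 a) ≡ false
sameParity-inc = from-yes (all? λ a → sameParity a (inc4 a) Bool.≟ false)

sameParity-antipode : ∀ a b → sameParity a (antipode b) ≡ sameParity a b
sameParity-antipode = from-yes (all? λ a → all? λ b → sameParity a (antipode b) Bool.≟ sameParity a b)

shift≢shift-inc : ∀ a x → shift a x ≢ shift (inc4 a) x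
shift≢shift-inc = from-yes (all? λ a → all? λ x → ¬? (shift a x ≟ shift (inc4 a) x))

antipode-shift : ∀ a x → antipode (shift a x) ≡ shift (inc4 a) x
antipode-shift = from-yes (all? λ a → all? λ x → antipode (shift a x) ≟ shift (inc4 a) x)

antipode-shift-inc : ∀ a x → antipode (shift (inc4 a) x) ≡ shift a x
antipode-shift-inc = from-yes (all? λ a → all? λ x → antipode (shift (inc4 a) x) ≟ shift a x)

shift-shift≢ : ∀ a x → shift a (shift a x) ≢ x
shift-shift≢ = from-yes (all? λ a → all? λ x → ¬? (shift a (shift a x) ≟ x))

-- Two ±1-neighbours of a are equal or antipodal, hence neighbours of b + 1.
neighbours-of-neighbour : ∀ a b c → Neighbour₄ a b → Neighbour₄ a c → Neighbour₄ (inc4 b) c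
neighbours-of-neighbour = from-yes (all? λ a → all? λ b → all? λ c →
  neighbour₄? a b →-dec neighbour₄? a c →-dec neighbour₄? (inc4 b) c)

-- Among x, y ∈ {c, c + (-1)^b} no two are antipodal: a star never meets two
-- antipodal copies.
not-antipodal : ∀ b c x y → (x ≡ c ⊎ x ≡ shift b c) → (y ≡ c ⊎ y ≡ shift b c) → y ≢ antipode x
not-antipodal = from-yes (all? λ b → all? λ c → all? λ x → all? λ y →
  ((x ≟ c) ⊎-dec (x ≟ shift b c)) →-dec ((y ≟ c) ⊎-dec (y ≟ shift b c)) →-dec ¬? (y ≟ antipode x))

-- Tails.  A neighbour of (a ∷ y) has tail y or y with one coordinate i replaced
-- by shift a (y i); `changeAt f y r` enumerates these, r = zero meaning "no change".

_≟ⱽ_ : ∀ {m} (x y : Vec (Fin 4) m) → Dec (x ≡ y)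
_≟ⱽ_ = ≡-dec _≟_

changeAt : ∀ {m} → (Fin 4 → Fin 4) → Vec (Fin 4) m → Fin (suc m) → Vec (Fin 4) m
changeAt f y zero = y
changeAt f y (suc i) = y [ i ]≔ f (lookup y i)

changeAt-injective : ∀ {m} f → (∀ c → f c ≢ c) → (y : Vec (Fin 4) m) →
                     ∀ r r' → changeAt f y r ≡ changeAt f y r' → r ≡ r'
changeAt-injective f nf y zero zero e = refl
changeAt-injective f nf y zero (suc i) e =
  ⊥-elim (nf (lookup y i) (trans (sym (lookup∘update i y _)) (cong (λ v → lookup v i) (sym e))))
changeAt-injective f nf y (suc i) zero e =
  ⊥-elim (nf (lookup y i) (trans (sym (lookup∘update i y _)) (cong (λ v → lookup v i) e)))
changeAt-injective f nf y (suc i) (suc i') e with i ≟ i'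
... | yes refl = refl
... | no i≢i' = ⊥-elim (nf (lookup y i)
      (trans (sym (lookup∘update i y _)) (trans (cong (λ v → lookup v i) e) (lookup∘update′ i≢i' y _))))

indexOf : ∀ {P} {B : Set} → ((b b' : B) → Dec (b ≡ b')) → (Fin P → B) → B → Maybe (Fin P)
indexOf _≟ᴮ_ g b with any? (λ p → b ≟ᴮ g p)
... | yes (p , _) = just p
... | no _ = nothing

indexOf-complete : ∀ {P} {B : Set} (_≟ᴮ_ : (b b' : B) → Dec (b ≡ b')) (g : Fin P → B) →
                   (∀ p q → g p ≡ g q → p ≡ q) → ∀ p → indexOf _≟ᴮ_ g (g p) ≡ just p
indexOf-complete _≟ᴮ_ g injective p with any? (λ q → g p ≟ᴮ g q)
... | yes (q , e) = cong just (sym (injective p q e))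
... | no none = ⊥-elim (none (p , refl))

changedCoordinate : ∀ {m} → (Fin 4 → Fin 4) → Vec (Fin 4) m → Vec (Fin 4) m → Maybe (Fin (suc m))
changedCoordinate f y = indexOf _≟ⱽ_ (changeAt f y)

changedCoordinate-complete : ∀ {m} f → (∀ c → f c ≢ c) → (y : Vec (Fin 4) m) (r : Fin (suc m)) →
                             changedCoordinate f y (changeAt f y r) ≡ just r
changedCoordinate-complete f nf y = indexOf-complete _≟ⱽ_ (changeAt f y) (changeAt-injective f nf y)

-- BH_n is an undirected graph: the shift of an edge is undone by its reverse.
adj-sym : ∀ {n} x y → Adj n x y → Adj n y x
adj-sym {suc m} (a ∷ xs) (b ∷ ys) (level , tl) = back level , backTail tl
  where
  back : Neighbour₄ a b → Neighbour₄ b a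
  back (inj₁ e) = inj₂ (trans (sym (dec-inc a)) (cong dec4 (sym e)))
  back (inj₂ e) = inj₁ (trans (sym (inc-dec a)) (cong inc4 (sym e)))
  backTail : (ys ≡ xs ⊎ ∃[ i ] ys ≡ xs [ i ]≔ shift a (lookup xs i)) →
             (xs ≡ ys ⊎ ∃[ i ] xs ≡ ys [ i ]≔ shift b (lookup ys i))
  backTail (inj₁ e) = inj₁ (sym e)
  backTail (inj₂ (i , refl)) = inj₂ (i , sym (begin
      (xs [ i ]≔ shift a (lookup xs i)) [ i ]≔ shift b (lookup (xs [ i ]≔ shift a (lookup xs i)) i)
        ≡⟨ cong (λ t → (xs [ i ]≔ shift a (lookup xs i)) [ i ]≔ shift b t) (lookup∘update i xs _) ⟩
      (xs [ i ]≔ shift a (lookup xs i)) [ i ]≔ shift b (shift a (lookup xs i))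
        ≡⟨ []≔-idempotent xs i ⟩
      xs [ i ]≔ shift b (shift a (lookup xs i))
        ≡⟨ cong (xs [ i ]≔_) (shift-inverse a b level (lookup xs i)) ⟩
      xs [ i ]≔ lookup xs i
        ≡⟨ []≔-lookup xs i ⟩
      xs ∎))
    where open ≡-Reasoning

adj-irrefl : ∀ {n} (v : Vertex n) → ¬ Adj n v v
adj-irrefl {suc m} (a ∷ xs) (inj₁ e , _) = shift≢ zero a (sym e)
adj-irrefl {suc m} (a ∷ xs) (inj₂ e , _) = shift≢ (suc zero) a (sym e)

-- The twin of a vertex differs from it by 2 in the first coordinate; twins have
-- the same neighbours, since the shift only depends on the parity of a₀.
twin : ∀ {m} → Vertex (suc m) → Vertex (suc m)
twin (a ∷ xs) = antipode a ∷ xs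

twin≢ : ∀ {m} (v : Vertex (suc m)) → twin v ≢ v
twin≢ (a ∷ xs) e = antipode≢ a (cong head e)

adj-twinˡ : ∀ {m} u v → Adj (suc m) u v → Adj (suc m) (twin u) v
adj-twinˡ (a ∷ xs) (b ∷ ys) (level , tl) = neighbour-antipode a b level , tail' tl
  where
  tail' : (ys ≡ xs ⊎ ∃[ i ] ys ≡ xs [ i ]≔ shift a (lookup xs i)) →
          (ys ≡ xs ⊎ ∃[ i ] ys ≡ xs [ i ]≔ shift (antipode a) (lookup xs i))
  tail' (inj₁ e) = inj₁ e
  tail' (inj₂ (i , e)) = inj₂ (i , trans e (cong (xs [ i ]≔_) (sym (shift-antipode a (lookup xs i)))))

adj-twinʳ : ∀ {m} u v → Adj (suc m) u v → Adj (suc m) u (twin v)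
adj-twinʳ u v e = adj-sym (twin v) u (adj-twinˡ v u (adj-sym u v e))

TwinOf : ∀ {m} → Vertex (suc m) → Vertex (suc m) → Set
TwinOf v t = t ≡ v ⊎ t ≡ twin v

adj-twins : ∀ {m} u v → Adj (suc m) u v → ∀ {u' v'} → TwinOf u u' → TwinOf v v' → Adj (suc m) u' v'
adj-twins u v e (inj₁ refl) (inj₁ refl) = e
adj-twins u v e (inj₁ refl) (inj₂ refl) = adj-twinʳ u v e
adj-twins u v e (inj₂ refl) (inj₁ refl) = adj-twinˡ u v e
adj-twins u v e (inj₂ refl) (inj₂ refl) = adj-twinʳ (twin u) v (adj-twinˡ u v e)

data Path {n : ℕ} (R : Vertex n → Set) : Vertex n → Vertex n → Set where
  here : ∀ {x} → ¬ R x → Path R x x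
  step : ∀ {x y z} → ¬ R x → Adj n x y → Path R y z → Path R x z

_++ᴾ_ : ∀ {n} {R : Vertex n → Set} {x y z} → Path R x y → Path R y z → Path R x z
here _ ++ᴾ q = q
step a e p ++ᴾ q = step a e (p ++ᴾ q)

path-start : ∀ {n} {R : Vertex n → Set} {x y} → Path R x y → ¬ R x
path-start (here a) = a
path-start (step a _ _) = a

path-end : ∀ {n} {R : Vertex n → Set} {x y} → Path R x y → ¬ R y
path-end (here a) = a
path-end (step _ _ p) = path-end p

edge : ∀ {n} {R : Vertex n → Set} {x y} → ¬ R x → ¬ R y → Adj n x y → Path R x y
edge a b e = step a e (here b)

path-sym : ∀ {n} {R : Vertex n → Set} {x y} → Path R x y → Path R y x
path-sym (here a) = here a
path-sym (step {x} {y} a e p) = path-sym p ++ᴾ edge (path-start p) a (adj-sym x y e)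

∑ : (P : ℕ) → (Fin P → ℕ) → ℕ
∑ zero f = 0
∑ (suc P) f = f zero + ∑ P (λ p → f (suc p))

∑ᴸ : {A : Set} → List A → (A → ℕ) → ℕ
∑ᴸ [] f = 0
∑ᴸ (x ∷ xs) f = f x + ∑ᴸ xs f

∑-+ : ∀ P (f g : Fin P → ℕ) → ∑ P (λ p → f p + g p) ≡ ∑ P f + ∑ P g
∑-+ zero f g = refl
∑-+ (suc P) f g =
  trans (cong (f zero + g zero +_) (∑-+ P (λ p → f (suc p)) (λ p → g (suc p))))
        (interchange (f zero) (g zero) (∑ P (λ p → f (suc p))) (∑ P (λ p → g (suc p))))
  where open import Algebra.Properties.CommutativeSemigroup +-commutativeSemigroup using (interchange)

∑-mono : ∀ P {f g : Fin P → ℕ} → (∀ p → f p ≤ g p) → ∑ P f ≤ ∑ P g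
∑-mono zero h = z≤n
∑-mono (suc P) h = +-mono-≤ (h zero) (∑-mono P (λ p → h (suc p)))

∑-const : ∀ P c → ∑ P (λ _ → c) ≡ P * c
∑-const zero c = refl
∑-const (suc P) c = cong (c +_) (∑-const P c)

∑-zero : ∀ P (f : Fin P → ℕ) → (∀ p → f p ≡ 0) → ∑ P f ≡ 0
∑-zero zero f h = refl
∑-zero (suc P) f h = trans (cong (_+ ∑ P (λ p → f (suc p))) (h zero)) (∑-zero P _ (λ p → h (suc p)))

∑-single : ∀ P (f : Fin P → ℕ) (q : Fin P) → (∀ p → p ≢ q → f p ≡ 0) → ∑ P f ≡ f q
∑-single (suc P) f zero h =
  trans (cong (f zero +_) (∑-zero P _ (λ p → h (suc p) (λ ())))) (+-identityʳ (f zero))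
∑-single (suc P) f (suc q) h =
  trans (cong (_+ ∑ P (λ p → f (suc p))) (h zero (λ ()))) (∑-single P (λ p → f (suc p)) q (λ p p≢q → h (suc p) (λ { refl → p≢q refl })))

∑-swap : ∀ {A : Set} P (L : List A) (g : A → Fin P → ℕ) →
         ∑ P (λ p → ∑ᴸ L (λ x → g x p)) ≡ ∑ᴸ L (λ x → ∑ P (g x))
∑-swap P [] g = ∑-zero P _ (λ _ → refl)
∑-swap P (x ∷ L) g = trans (∑-+ P (g x) (λ p → ∑ᴸ L (λ x' → g x' p))) (cong (∑ P (g x) +_) (∑-swap P L g))

∑ᴸ-bound : ∀ {A : Set} (L : List A) (f : A → ℕ) b → All (λ x → f x ≤ b) L → ∑ᴸ L f ≤ length L * b
∑ᴸ-bound [] f b [] = z≤n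
∑ᴸ-bound (x ∷ L) f b (h ∷ hs) = +-mono-≤ h (∑ᴸ-bound L f b hs)

∑ᴸ-member : ∀ {A : Set} {x : A} (L : List A) (f : A → ℕ) → Any (x ≡_) L → f x ≤ ∑ᴸ L f
∑ᴸ-member (y ∷ L) f (here refl) = m≤m+n (f y) _
∑ᴸ-member (y ∷ L) f (there m) = ≤-trans (∑ᴸ-member L f m) (m≤n+m _ (f y))

∑ᴸ-pair : ∀ {A : Set} {x y : A} (L : List A) (f : A → ℕ) → x ≢ y →
          Any (x ≡_) L → Any (y ≡_) L → f x + f y ≤ ∑ᴸ L f
∑ᴸ-pair (z ∷ L) f x≢y (here refl) (here refl) = ⊥-elim (x≢y refl)
∑ᴸ-pair (z ∷ L) f x≢y (here refl) (there my) = +-monoʳ-≤ (f z) (∑ᴸ-member L f my)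
∑ᴸ-pair {x = x} (z ∷ L) f x≢y (there mx) (here refl) =
  subst (_≤ f z + ∑ᴸ L f) (+-comm (f z) (f x)) (+-monoʳ-≤ (f z) (∑ᴸ-member L f mx))
∑ᴸ-pair (z ∷ L) f x≢y (there mx) (there my) = ≤-trans (∑ᴸ-pair L f x≢y mx my) (m≤n+m _ (f z))

-- min2 x = min(x, 2): the part of a count that matters for "hit twice".
min2 : ℕ → ℕ
min2 zero = zero
min2 (suc zero) = 1
min2 (suc (suc _)) = 2

-- Elementary properties of min2; subadditivity is what makes per-star bounds add up.
min2≤2 : ∀ x → min2 x ≤ 2
min2≤2 zero = z≤n
min2≤2 (suc zero) = s≤s z≤n
min2≤2 (suc (suc x)) = ≤-refl

min2≤ : ∀ x → min2 x ≤ x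
min2≤ zero = z≤n
min2≤ (suc zero) = ≤-refl
min2≤ (suc (suc x)) = s≤s (s≤s z≤n)

min2-of-≥2 : ∀ x → 2 ≤ x → min2 x ≡ 2
min2-of-≥2 (suc (suc x)) (s≤s (s≤s z≤n)) = refl

min2-subadditive : ∀ x y → min2 (x + y) ≤ min2 x + min2 y
min2-subadditive zero y = ≤-refl
min2-subadditive (suc zero) zero = s≤s z≤n
min2-subadditive (suc zero) (suc zero) = ≤-refl
min2-subadditive (suc zero) (suc (suc y)) = s≤s (s≤s z≤n)
min2-subadditive (suc (suc x)) y = s≤s (s≤s z≤n)

min2-∑ᴸ : ∀ {A : Set} (L : List A) (f : A → ℕ) → min2 (∑ᴸ L f) ≤ ∑ᴸ L (λ x → min2 (f x))
min2-∑ᴸ [] f = z≤n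
min2-∑ᴸ (x ∷ L) f = ≤-trans (min2-subadditive (f x) (∑ᴸ L f)) (+-monoʳ-≤ (min2 (f x)) (min2-∑ᴸ L f))

indicator : ∀ {P} → Fin P → Fin P → ℕ
indicator q p with q ≟ p
... | yes _ = 1
... | no _ = 0

indicator-self : ∀ {P} (q : Fin P) → indicator q q ≡ 1
indicator-self q with q ≟ q
... | yes _ = refl
... | no q≢q = ⊥-elim (q≢q refl)

indicator-other : ∀ {P} (q p : Fin P) → p ≢ q → indicator q p ≡ 0
indicator-other q p p≢q with q ≟ p
... | yes q≡p = ⊥-elim (p≢q (sym q≡p))
... | no _ = refl

∑-indicator : ∀ P (q : Fin P) → ∑ P (indicator q) ≡ 1
∑-indicator P q = trans (∑-single P (indicator q) q (indicator-other q)) (indicator-self q)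

Slot : ∀ {n} → Vertex n → Star n → Set
Slot v s = v ≡ Star.centre s ⊎ v ≡ Star.leaf1 s ⊎ v ≡ Star.leaf2 s

slots : ∀ {n} → Star n → List (Vertex n)
slots (star c u w) = c ∷ u ∷ w ∷ []

slot-member : ∀ {n} {v : Vertex n} (s : Star n) → Slot v s → Any (v ≡_) (slots s)
slot-member (star c u w) (inj₁ e) = here e
slot-member (star c u w) (inj₂ (inj₁ e)) = there (here e)
slot-member (star c u w) (inj₂ (inj₂ e)) = there (there (here e))

-- A star in the sense used by the induction: a centre adjacent to both leaves
-- (leaves may coincide; restriction to a copy can produce such stars).
IsPiece : ∀ {n} → Star n → Set
IsPiece {n} (star c u w) = Adj n c u × Adj n c w

-- Pigeonhole for families of vertex-disjoint paths.  The P paths are encoded by a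
-- partial tagging of vertices with indices p : Fin P; path p is destroyed only if
-- two of its vertices are removed.  If every star can contribute to at most b
-- such double hits and |F|·b < 2P, some index is hit fewer than twice.
module Pigeonhole {n : ℕ} (P : ℕ) (tag : Vertex n → Maybe (Fin P)) where

  hitᴹ : Maybe (Fin P) → Fin P → ℕ
  hitᴹ nothing p = 0
  hitᴹ (just q) p = indicator q p

  hit : Vertex n → Fin P → ℕ
  hit v p = hitᴹ (tag v) p

  load : Star n → Fin P → ℕ
  load s p = ∑ᴸ (slots s) (λ v → hit v p)

  total : List (Star n) → Fin P → ℕ
  total F p = ∑ᴸ F (λ s → load s p)

  -- How much the star s can contribute towards hitting indices twice.
  weight : Star n → ℕ
  weight s = ∑ P (λ p → min2 (load s p))

  ∑-hit : ∀ v → ∑ P (hit v) ≤ 1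
  ∑-hit v with tag v
  ... | nothing = ≤-trans (≤-reflexive (∑-zero P _ (λ _ → refl))) z≤n
  ... | just q = ≤-reflexive (∑-indicator P q)

  ∑-hit-untagged : ∀ v → tag v ≡ nothing → ∑ P (hit v) ≡ 0
  ∑-hit-untagged v e = ∑-zero P (hit v) (λ p → cong (λ t → hitᴹ t p) e)

  hit-tagged : ∀ v p → tag v ≡ just p → hit v p ≡ 1
  hit-tagged v p e = trans (cong (λ t → hitᴹ t p) e) (indicator-self p)

  -- The pigeonhole principle: if all indices were hit twice, the total weight
  -- 2P would exceed |F|·b.
  light-index : (F : List (Star n)) (b : ℕ) → All (λ s → weight s ≤ b) F → length F * b < 2 * P →
                ∃ λ p → ¬ 2 ≤ total F p
  light-index F b bounded small = ¬∀⟶∃¬ P _ (λ p → 2 ≤? total F p) allHeavy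
    where
    allHeavy : ¬ (∀ p → 2 ≤ total F p)
    allHeavy heavy = <-irrefl refl (≤-<-trans chain small)
      where
      chain : 2 * P ≤ length F * b
      chain = begin
        2 * P                                     ≡⟨ *-comm 2 P ⟩
        P * 2                                     ≡⟨ ∑-const P 2 ⟨
        ∑ P (λ _ → 2)                             ≤⟨ ∑-mono P (λ p → ≤-reflexive (sym (min2-of-≥2 _ (heavy p)))) ⟩
        ∑ P (λ p → min2 (total F p))              ≤⟨ ∑-mono P (λ p → min2-∑ᴸ F (λ s → load s p)) ⟩
        ∑ P (λ p → ∑ᴸ F (λ s → min2 (load s p)))  ≡⟨ ∑-swap P F (λ s p → min2 (load s p)) ⟩
        ∑ᴸ F weight                               ≤⟨ ∑ᴸ-bound F weight b bounded ⟩
        length F * b                              ∎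
        where open ≤-Reasoning

  hit≤total : ∀ (F : List (Star n)) {v} p → InV F v → hit v p ≤ total F p
  hit≤total (s ∷ F) p (here m) = ≤-trans (∑ᴸ-member (slots s) (λ x → hit x p) (slot-member s m)) (m≤m+n _ _)
  hit≤total (s ∷ F) p (there m) = ≤-trans (hit≤total F p m) (m≤n+m _ _)

  hit-twice : ∀ (F : List (Star n)) {v v'} p → v ≢ v' → tag v ≡ just p → tag v' ≡ just p →
              InV F v → InV F v' → 2 ≤ total F p
  hit-twice F {v} {v'} p v≢v' tv tv' inV inV' =
    subst₂ (λ a b → a + b ≤ total F p) (hit-tagged v p tv) (hit-tagged v' p tv') (go F inV inV')
    where
    f : Vertex n → ℕ
    f x = hit x p
    go : ∀ F → InV F v → InV F v' → f v + f v' ≤ total F p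
    go (s ∷ F) (here m) (here m') =
      ≤-trans (∑ᴸ-pair (slots s) f v≢v' (slot-member s m) (slot-member s m')) (m≤m+n _ _)
    go (s ∷ F) (here m) (there m') = +-mono-≤ (∑ᴸ-member (slots s) f (slot-member s m)) (hit≤total F p m')
    go (s ∷ F) (there m) (here m') =
      ≤-trans (+-mono-≤ (hit≤total F p m) (∑ᴸ-member (slots s) f (slot-member s m'))) (≤-reflexive (+-comm (total F p) (load s p)))
    go (s ∷ F) (there m) (there m') = ≤-trans (go F m m') (m≤n+m _ _)

  surviving : ∀ (F : List (Star n)) (R : Vertex n → Set) → (∀ v → Dec (R v)) → (∀ v → R v → InV F v) →
              ∀ {v v'} p → ¬ 2 ≤ total F p → v ≢ v' → tag v ≡ just p → tag v' ≡ just p →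
              ∃ λ t → (t ≡ v ⊎ t ≡ v') × ¬ R t
  surviving F R R? covered {v} {v'} p light v≢v' tv tv' with R? v
  ... | no v-alive = v , inj₁ refl , v-alive
  ... | yes rv = v' , inj₂ refl , λ rv' → light (hit-twice F p v≢v' tv tv' (covered _ rv) (covered _ rv'))

  weight≤tagged : ∀ s → weight s ≤ ∑ᴸ (slots s) (λ v → ∑ P (hit v))
  weight≤tagged s = ≤-trans (∑-mono P (λ p → min2≤ _)) (≤-reflexive (∑-swap P (slots s) hit))

  TagsAgree : Set
  TagsAgree = ∀ v v' {p q} → Adj n v v' → tag v ≡ just p → tag v' ≡ just q → p ≡ q

  -- Then a star can only contribute to one index through its centre, or to the
  -- (at most two) indices of its leaves: its weight is at most 2.
  weight≤2 : TagsAgree → ∀ s → IsPiece s → weight s ≤ 2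
  weight≤2 agree (star c u w) (cu , cw) = byCentre (tag c) refl
    where
    byCentre : (t : Maybe (Fin P)) → tag c ≡ t → weight (star c u w) ≤ 2
    byCentre (just p₀) tc = ≤-trans (≤-reflexive (∑-single P _ p₀ offCentre)) (min2≤2 _)
      where
      quiet : ∀ {v} p → p ≢ p₀ → Adj n c v → hit v p ≡ 0
      quiet {v} p p≢p₀ cv with tag v in tv
      ... | nothing = refl
      ... | just q = indicator-other q p (λ p≡q → p≢p₀ (trans p≡q (sym (agree c v cv tc tv))))
      offCentre : ∀ p → p ≢ p₀ → min2 (load (star c u w) p) ≡ 0
      offCentre p p≢p₀ = cong min2 (cong₂ _+_
        (trans (cong (λ t → hitᴹ t p) tc) (indicator-other p₀ p p≢p₀))
        (cong₂ _+_ (quiet p p≢p₀ cu) (cong (_+ 0) (quiet p p≢p₀ cw))))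
    byCentre nothing tc = begin
      weight (star c u w)        ≤⟨ ∑-mono P (λ p → ≤-trans (min2≤ _) (≤-reflexive (leavesOnly p))) ⟩
      ∑ P (λ p → hit u p + hit w p) ≡⟨ ∑-+ P (hit u) (hit w) ⟩
      ∑ P (hit u) + ∑ P (hit w)  ≤⟨ +-mono-≤ (∑-hit u) (∑-hit w) ⟩
      2                          ∎
      where
      open ≤-Reasoning
      leavesOnly : ∀ p → load (star c u w) p ≡ hit u p + hit w p
      leavesOnly p = cong₂ _+_ (cong (λ t → hitᴹ t p) tc) (cong (hit u p +_) (+-identityʳ (hit w p)))

module TwinPigeonhole {m : ℕ} (P : ℕ) (tag : Vertex (suc m) → Maybe (Fin P))
                      (tag-twin : ∀ v → tag (twin v) ≡ tag v) where

  open Pigeonhole P tag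

  twin-survives : ∀ (F : List (Star (suc m))) (R : Vertex (suc m) → Set) → (∀ v → Dec (R v)) →
                  (∀ v → R v → InV F v) → ∀ v {p} → ¬ 2 ≤ total F p → tag v ≡ just p →
                  ∃ λ t → TwinOf v t × ¬ R t
  twin-survives F R R? covered v light tv =
    surviving F R R? covered _ light (λ e → twin≢ v (sym e)) tv (trans (tag-twin v) tv)

-- The copies of BH_{M+2}.  Fixing a₁ = j gives a copy of BH_{M+1}; emb j and proj
-- are the two directions of this isomorphism.

copyOf : ∀ {M} → Vertex (suc (suc M)) → Fin 4
copyOf (_ ∷ c ∷ _) = c

emb : ∀ {M} → Fin 4 → Vertex (suc M) → Vertex (suc (suc M))
emb j (a ∷ y) = a ∷ j ∷ y

proj : ∀ {M} → Vertex (suc (suc M)) → Vertex (suc M)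
proj (a ∷ c ∷ y) = a ∷ y

copy-twin : ∀ {M} {v t : Vertex (suc (suc M))} → TwinOf v t → copyOf t ≡ copyOf v
copy-twin {v = a ∷ c ∷ y} (inj₁ refl) = refl
copy-twin {v = a ∷ c ∷ y} (inj₂ refl) = refl

emb-proj : ∀ {M} j (v : Vertex (suc (suc M))) → copyOf v ≡ j → emb j (proj v) ≡ v
emb-proj j (a ∷ c ∷ y) refl = refl

InnerOrCross : ∀ {M} → Fin 4 → Fin 4 → Vec (Fin 4) M → Fin 4 → Vec (Fin 4) M → Set
InnerOrCross a c y c' y' =
  (c' ≡ c × (y' ≡ y ⊎ ∃[ i ] y' ≡ y [ i ]≔ shift a (lookup y i))) ⊎ (c' ≡ shift a c × y' ≡ y)

adj-split : ∀ {M} a c (y : Vec (Fin 4) M) b c' y' → Adj (suc (suc M)) (a ∷ c ∷ y) (b ∷ c' ∷ y') →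
            Neighbour₄ a b × InnerOrCross a c y c' y'
adj-split a c y b .c .y (level , inj₁ refl) = level , inj₁ (refl , inj₁ refl)
adj-split a c y b ._ ._ (level , inj₂ (zero , refl)) = level , inj₂ (refl , refl)
adj-split a c y b ._ ._ (level , inj₂ (suc i , refl)) = level , inj₁ (refl , inj₂ (i , refl))

adj-copy : ∀ {M} (z u : Vertex (suc (suc M))) → Adj (suc (suc M)) z u →
           copyOf u ≡ copyOf z ⊎ copyOf u ≡ shift (head z) (copyOf z)
adj-copy (a ∷ c ∷ y) (b ∷ c' ∷ y') adj with adj-split a c y b c' y' adj
... | _ , inj₁ (e , _) = inj₁ e
... | _ , inj₂ (e , _) = inj₂ e

adj-parity : ∀ {M} a (z u : Vertex (suc (suc M))) → Adj (suc (suc M)) z u →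
             sameParity a (head u) ≡ not (sameParity a (head z))
adj-parity a (b ∷ _) (b' ∷ _) adj = sameParity-flip a b b' (proj₁ adj)

adj-emb : ∀ {M} j v v' → Adj (suc M) v v' → Adj (suc (suc M)) (emb j v) (emb j v')
adj-emb j (a ∷ y) (b ∷ y') (level , inj₁ e) = level , inj₁ (cong (j ∷_) e)
adj-emb j (a ∷ y) (b ∷ y') (level , inj₂ (i , e)) = level , inj₂ (suc i , cong (j ∷_) e)

adj-proj : ∀ {M} (z u : Vertex (suc (suc M))) → copyOf u ≡ copyOf z →
           Adj (suc (suc M)) z u → Adj (suc M) (proj z) (proj u)
adj-proj (a ∷ c ∷ y) (b ∷ c' ∷ y') same adj with adj-split a c y b c' y' adj
... | level , inj₁ (_ , inj₁ e) = level , inj₁ e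
... | level , inj₁ (_ , inj₂ (i , e)) = level , inj₂ (i , e)
... | level , inj₂ (e , _) = ⊥-elim (shift≢ a c (trans (sym e) same))

path-emb : ∀ {M} j (R : Vertex (suc (suc M)) → Set) {p q} →
           Path (R ∘ emb j) p q → Path R (emb j p) (emb j q)
path-emb j R (here a) = here a
path-emb j R (step {x} {y} a e p) = step a (adj-emb j x y e) (path-emb j R p)

cross-tail : ∀ {M} (z u : Vertex (suc (suc M))) → Adj (suc (suc M)) z u → copyOf u ≢ copyOf z →
             Neighbour₄ (head z) (head u) × proj u ≡ head u ∷ tail (proj z)
cross-tail (a ∷ c ∷ y) (b ∷ c' ∷ y') adj c'≢c with adj-split a c y b c' y' adj
... | level , inj₁ (e , _) = ⊥-elim (c'≢c e)
... | level , inj₂ (_ , refl) = level , refl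

Meets : ∀ {M} → Fin 4 → Star (suc (suc M)) → Set
Meets j (star z u w) = copyOf z ≡ j ⊎ copyOf u ≡ j ⊎ copyOf w ≡ j

-- A star meets at most two copies, c and c + (-1)^{a₀} of its centre; these are
-- never antipodal.
meets-not-antipodal : ∀ {M} j (s : Star (suc (suc M))) → IsPiece s → Meets j s → ¬ Meets (antipode j) s
meets-not-antipodal j (star z u w) (zu , zw) mj mj' =
  not-antipodal (head z) (copyOf z) j (antipode j) (copyOfSlot mj) (copyOfSlot mj') refl
  where
  copyOfSlot : ∀ {k} → Meets k (star z u w) → k ≡ copyOf z ⊎ k ≡ shift (head z) (copyOf z)
  copyOfSlot (inj₁ refl) = inj₁ refl
  copyOfSlot (inj₂ (inj₁ refl)) = adj-copy z u zu
  copyOfSlot (inj₂ (inj₂ refl)) = adj-copy z w zw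

-- A star meeting copy j becomes a
-- star of that copy covering its vertices there.  If its centre z lies in the
-- copy, outside leaves are replaced by the inner neighbour (a₀+1, tail) of z.
-- Otherwise its leaves in the copy are cross neighbours of z; they share the
-- tail of z and are adjacent to the inner neighbour of either of them.

module Restriction {M : ℕ} where

  innerNeighbour : Vertex (suc (suc M)) → Vertex (suc M)
  innerNeighbour (a ∷ c ∷ y) = inc4 a ∷ y

  adj-innerNeighbour : ∀ z → Adj (suc M) (innerNeighbour z) (proj z)
  adj-innerNeighbour (a ∷ c ∷ y) = inj₂ (sym (dec-inc a)) , inj₁ refl

  leafOfCentre : Fin 4 → Vertex (suc (suc M)) → Vertex (suc (suc M)) → Vertex (suc M)
  leafOfCentre j z v with copyOf v ≟ j
  ... | yes _ = proj v
  ... | no _ = innerNeighbour z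

  secondLeaf : Fin 4 → Vertex (suc (suc M)) → Vertex (suc (suc M)) → Vertex (suc M)
  secondLeaf j u w with copyOf w ≟ j
  ... | yes _ = proj w
  ... | no _ = proj u

  restrict : Fin 4 → Star (suc (suc M)) → Maybe (Star (suc M))
  restrict j (star z u w) with copyOf z ≟ j
  ... | yes _ = just (star (proj z) (leafOfCentre j z u) (leafOfCentre j z w))
  ... | no _ with copyOf u ≟ j
  ...   | yes _ = just (star (innerNeighbour u) (proj u) (secondLeaf j u w))
  ...   | no _ with copyOf w ≟ j
  ...     | yes _ = just (star (innerNeighbour w) (proj w) (proj w))
  ...     | no _ = nothing

  restrict-meets : ∀ j s {s'} → restrict j s ≡ just s' → Meets j s
  restrict-meets j (star z u w) e with copyOf z ≟ j
  ... | yes zj = inj₁ zj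
  ... | no _ with copyOf u ≟ j
  ...   | yes uj = inj₂ (inj₁ uj)
  ...   | no _ with copyOf w ≟ j
  ...     | yes wj = inj₂ (inj₂ wj)
  restrict-meets j (star z u w) () | no _ | no _ | no _

  restrict-piece : ∀ j s {s'} → IsPiece s → restrict j s ≡ just s' → IsPiece s'
  restrict-piece j (star z u w) (zu , zw) e with copyOf z ≟ j
  restrict-piece j (star z u w) (zu , zw) refl | yes zj = toLeaf u zu , toLeaf w zw
    where
    toLeaf : ∀ v → Adj _ z v → Adj (suc M) (proj z) (leafOfCentre j z v)
    toLeaf v zv with copyOf v ≟ j
    ... | yes vj = adj-proj z v (trans vj (sym zj)) zv
    ... | no _ = adj-sym _ _ (adj-innerNeighbour z)
  ... | no zj with copyOf u ≟ j
  restrict-piece j (star z u w) (zu , zw) refl | no zj | yes uj = adj-innerNeighbour u , toSecond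
    where
    toSecond : Adj (suc M) (innerNeighbour u) (secondLeaf j u w)
    toSecond with copyOf w ≟ j
    ... | no _ = adj-innerNeighbour u
    ... | yes wj with cross-tail z u zu (λ e → zj (trans (sym e) uj))
                    | cross-tail z w zw (λ e → zj (trans (sym e) wj))
    ...   | zu' , tu | zw' , tw = sharedTail u w tu tw (neighbours-of-neighbour (head z) (head u) (head w) zu' zw')
      where
      sharedTail : ∀ u w → proj u ≡ head u ∷ tail (proj z) → proj w ≡ head w ∷ tail (proj z) →
                   Neighbour₄ (inc4 (head u)) (head w) → Adj (suc M) (innerNeighbour u) (proj w)
      sharedTail (b ∷ c ∷ yu) (b' ∷ c' ∷ yw) refl refl level = level , inj₁ refl
  ... | no uj with copyOf w ≟ j
  restrict-piece j (star z u w) (zu , zw) refl | no zj | no uj | yes wj =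
    adj-innerNeighbour w , adj-innerNeighbour w
  restrict-piece j (star z u w) (zu , zw) () | no zj | no uj | no wj

  restrict-covers : ∀ j v s → Slot (emb j v) s → ∃ λ s' → restrict j s ≡ just s' × Slot v s'
  restrict-covers j (a ∷ y) (star z u w) sl with copyOf z ≟ j
  ... | yes _ = _ , refl , atCentre sl
    where
    self : ∀ {x} → leafOfCentre j x (a ∷ j ∷ y) ≡ a ∷ y
    self with j ≟ j
    ... | yes _ = refl
    ... | no j≢j = ⊥-elim (j≢j refl)
    atCentre : Slot (a ∷ j ∷ y) (star z u w) → Slot (a ∷ y) (star (proj z) (leafOfCentre j z u) (leafOfCentre j z w))
    atCentre (inj₁ refl) = inj₁ refl
    atCentre (inj₂ (inj₁ refl)) = inj₂ (inj₁ (sym self))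
    atCentre (inj₂ (inj₂ refl)) = inj₂ (inj₂ (sym self))
  ... | no zj with copyOf u ≟ j
  ...   | yes _ = _ , refl , atLeaf sl
    where
    self : secondLeaf j u (a ∷ j ∷ y) ≡ a ∷ y
    self with j ≟ j
    ... | yes _ = refl
    ... | no j≢j = ⊥-elim (j≢j refl)
    atLeaf : Slot (a ∷ j ∷ y) (star z u w) → Slot (a ∷ y) (star (innerNeighbour u) (proj u) (secondLeaf j u w))
    atLeaf (inj₁ refl) = ⊥-elim (zj refl)
    atLeaf (inj₂ (inj₁ refl)) = inj₂ (inj₁ refl)
    atLeaf (inj₂ (inj₂ refl)) = inj₂ (inj₂ (sym self))
  ...   | no uj with copyOf w ≟ j
  ...     | yes _ = _ , refl , atLeaf sl
    where
    atLeaf : Slot (a ∷ j ∷ y) (star z u w) → Slot (a ∷ y) (star (innerNeighbour w) (proj w) (proj w))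
    atLeaf (inj₁ refl) = ⊥-elim (zj refl)
    atLeaf (inj₂ (inj₁ refl)) = ⊥-elim (uj refl)
    atLeaf (inj₂ (inj₂ refl)) = inj₂ (inj₁ refl)
  restrict-covers j (a ∷ y) (star z u w) (inj₁ refl) | no zj | no uj | no wj = ⊥-elim (zj refl)
  restrict-covers j (a ∷ y) (star z u w) (inj₂ (inj₁ refl)) | no zj | no uj | no wj = ⊥-elim (uj refl)
  restrict-covers j (a ∷ y) (star z u w) (inj₂ (inj₂ refl)) | no zj | no uj | no wj = ⊥-elim (wj refl)

  restrictAll : Fin 4 → List (Star (suc (suc M))) → List (Star (suc M))
  restrictAll j [] = []
  restrictAll j (s ∷ F) with restrict j s
  ... | just s' = s' ∷ restrictAll j F
  ... | nothing = restrictAll j F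

  restrictAll-pieces : ∀ j F → All IsPiece F → All IsPiece (restrictAll j F)
  restrictAll-pieces j [] [] = []
  restrictAll-pieces j (s ∷ F) (p ∷ ps) with restrict j s in e
  ... | just s' = restrict-piece j s p e ∷ restrictAll-pieces j F ps
  ... | nothing = restrictAll-pieces j F ps

  restrictAll-covers : ∀ j F v → InV F (emb j v) → InV (restrictAll j F) v
  restrictAll-covers j (s ∷ F) v (here sl) with restrict-covers j v s sl
  ... | s' , e , sl' rewrite e = here sl'
  restrictAll-covers j (s ∷ F) v (there m) with restrict j s
  ... | just s' = there (restrictAll-covers j F v m)
  ... | nothing = restrictAll-covers j F v m

  restrictAll-length : ∀ j F → length (restrictAll j F) ≤ length F
  restrictAll-length j [] = z≤n
  restrictAll-length j (s ∷ F) with restrict j s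
  ... | just _ = s≤s (restrictAll-length j F)
  ... | nothing = ≤-trans (restrictAll-length j F) (n≤1+n _)

  restrictAll-full : ∀ j F → length F ≤ length (restrictAll j F) → All (Meets j) F
  restrictAll-full j [] _ = []
  restrictAll-full j (s ∷ F) long with restrict j s in e
  ... | just _ = restrict-meets j s e ∷ restrictAll-full j F (≤-pred long)
  ... | nothing = ⊥-elim (<-irrefl refl (≤-trans long (restrictAll-length j F)))

  restrictAll-empty : ∀ j F → All (λ s → ¬ Meets j s) F → restrictAll j F ≡ []
  restrictAll-empty j [] [] = refl
  restrictAll-empty j (s ∷ F) (miss ∷ misses) with restrict j s in e
  ... | just _ = ⊥-elim (miss (restrict-meets j s e))
  ... | nothing = restrictAll-empty j F misses

-- In each of the three constructions below the
-- candidate paths use pairs of twins (which have the same neighbours), so a path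
-- is destroyed only if both twins of some pair are removed; tagging both twins
-- with the index of their path puts us in the situation of `Pigeonhole`.

-- The counting condition for M+1 stars of weight 2 and M+2 paths.
k*2<2*[1+N] : ∀ k N → k ≤ N → k * 2 < 2 * suc N
k*2<2*[1+N] k N k≤N = begin-strict
  k * 2         ≡⟨ *-comm k 2 ⟩
  2 * k         ≤⟨ *-monoʳ-≤ 2 k≤N ⟩
  2 * N         <⟨ *-monoʳ-< 2 (n<1+n N) ⟩
  2 * suc N     ∎
  where open ≤-Reasoning

-- From x = (a, j, y) there are M+2 disjoint paths
-- into copies j ± 1: x — (a+1, s j, y) with s = shift a, and for each r
-- x — (a+1, j, y⁽ʳ⁾) — (a, s' j, y⁽ʳ⁾) with s' = shift (a+1), where y⁽ʳ⁾ = changeAt s y r.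
-- A vertex is tagged by the path it lies on; separation holds because an edge
-- between two such paths would have to cross between copies s j and s' j.
module Escape {M : ℕ} (a j : Fin 4) (y : Vec (Fin 4) M) where

  s s' : Fin 4 → Fin 4
  s = shift a
  s' = shift (inc4 a)

  -- One path through the cross neighbour, one per tail changeAt s y r.
  P : ℕ
  P = suc (suc M)

  -- The tag of a vertex with the same (true) or opposite (false) parity as a.
  tagAt : Bool → Fin 4 → Vec (Fin 4) M → Maybe (Fin P)
  tagAt true c y' with c ≟ s' j
  ... | yes _ = Maybe.map suc (changedCoordinate s y y')
  ... | no _ = nothing
  tagAt false c y' with c ≟ s j | c ≟ j | y' ≟ⱽ y
  ... | yes _ | _ | yes _ = just zero
  ... | yes _ | _ | no _ = nothing
  ... | no _ | yes _ | _ = Maybe.map suc (changedCoordinate s y y')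
  ... | no _ | no _ | _ = nothing

  -- Index 0 tags the cross twins, index 1+r the twins of the r-th inner/far pair.
  tag : Vertex (suc (suc M)) → Maybe (Fin P)
  tag (b ∷ c ∷ y') = tagAt (sameParity a b) c y'

  open Pigeonhole P tag

  tag-twin : ∀ v → tag (twin v) ≡ tag v
  tag-twin (b ∷ c ∷ y') = cong (λ t → tagAt t c y') (sameParity-antipode a b)

  open TwinPigeonhole P tag tag-twin

  tagAt-same : ∀ c y' {p} → tagAt true c y' ≡ just p → c ≡ s' j × Maybe.map suc (changedCoordinate s y y') ≡ just p
  tagAt-same c y' e with c ≟ s' j
  ... | yes c≡s'j = c≡s'j , e

  tagAt-same-s'j : ∀ y' → tagAt true (s' j) y' ≡ Maybe.map suc (changedCoordinate s y y')
  tagAt-same-s'j y' with s' j ≟ s' j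
  ... | yes _ = refl
  ... | no s'j≢s'j = ⊥-elim (s'j≢s'j refl)

  tagAt-opp-s'j : ∀ y' → tagAt false (s' j) y' ≡ nothing
  tagAt-opp-s'j y' with s' j ≟ s j | s' j ≟ j
  ... | yes e | _ = ⊥-elim (shift≢shift-inc a j (sym e))
  ... | no _ | yes e = ⊥-elim (shift≢ (inc4 a) j e)
  ... | no _ | no _ = refl

  tagAt-opp-j : ∀ y' → tagAt false j y' ≡ Maybe.map suc (changedCoordinate s y y')
  tagAt-opp-j y' with j ≟ s j | j ≟ j
  ... | yes e | _ = ⊥-elim (shift≢ a j (sym e))
  ... | no _ | yes _ = refl
  ... | no _ | no j≢j = ⊥-elim (j≢j refl)

  tagAt-opp-sj : tagAt false (s j) y ≡ just zero
  tagAt-opp-sj with s j ≟ s j | s j ≟ j | y ≟ⱽ y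
  ... | yes _ | _ | yes _ = refl
  ... | yes _ | _ | no y≢y = ⊥-elim (y≢y refl)
  ... | no sj≢sj | _ | _ = ⊥-elim (sj≢sj refl)

  -- A tagged vertex of a's parity lies in copy s' j; its tagged neighbours are
  -- its cross neighbours in copy j, carrying the same tail and tag.
  agree-from-same : ∀ v v' {p q} → sameParity a (head v) ≡ true → Adj _ v v' →
                    tag v ≡ just p → tag v' ≡ just q → p ≡ q
  agree-from-same (b ∷ c ∷ y') (b' ∷ c' ∷ y'') same adj tv tv'
    rewrite same | sameParity-flip a b b' (proj₁ adj) | same
    with tagAt-same c y' tv | proj₂ (adj-split b c y' b' c' y'' adj)
  ... | refl , cc | inj₂ (c'≡ , refl) rewrite trans c'≡ (shift-sameParity a b same (s' j))
                                           | shift-inverse (inc4 a) a (inj₂ (sym (dec-inc a))) j =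
    just-injective (trans (sym cc) (trans (sym (tagAt-opp-j y')) tv'))
  ... | refl , cc | inj₁ (refl , _) with trans (sym (tagAt-opp-s'j y'')) tv'
  ...   | ()

  agree : TagsAgree
  agree v v' adj tv tv' with sameParity a (head v) in e
  ... | true = agree-from-same v v' e adj tv tv'
  ... | false = sym (agree-from-same v' v (trans (adj-parity a v v' adj) (cong not e)) (adj-sym v v' adj) tv' tv)

  x : Vertex (suc (suc M))
  x = a ∷ j ∷ y

  cross : Vertex (suc (suc M))
  cross = inc4 a ∷ s j ∷ y

  inner far : Fin (suc M) → Vertex (suc (suc M))
  inner r = inc4 a ∷ j ∷ changeAt s y r
  far r = a ∷ s' j ∷ changeAt s y r

  tag-cross : tag cross ≡ just zero
  tag-cross rewrite sameParity-inc a = tagAt-opp-sj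

  tag-inner : ∀ r → tag (inner r) ≡ just (suc r)
  tag-inner r rewrite sameParity-inc a | tagAt-opp-j (changeAt s y r)
                    | changedCoordinate-complete s (shift≢ a) y r = refl

  tag-far : ∀ r → tag (far r) ≡ just (suc r)
  tag-far r rewrite sameParity-refl a | tagAt-same-s'j (changeAt s y r)
                  | changedCoordinate-complete s (shift≢ a) y r = refl

  x~cross : Adj _ x cross
  x~cross = inj₁ refl , inj₂ (zero , refl)

  x~inner : ∀ r → Adj _ x (inner r)
  x~inner zero = inj₁ refl , inj₁ refl
  x~inner (suc i) = inj₁ refl , inj₂ (suc i , refl)

  inner~far : ∀ r → Adj _ (inner r) (far r)
  inner~far r = inj₂ (sym (dec-inc a)) , inj₂ (zero , refl)

  escape : (R : Vertex (suc (suc M)) → Set) → (∀ v → Dec (R v)) → (F : List (Star (suc (suc M)))) →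
           All IsPiece F → length F ≤ suc M → (∀ v → R v → InV F v) → ¬ R x →
           ∃ λ t → Path R x t × (copyOf t ≡ s j ⊎ copyOf t ≡ s' j)
  escape R R? F pieces short covered x-alive =
    follow (light-index F 2 (All.map (λ {s} → weight≤2 agree s) pieces) (k*2<2*[1+N] _ _ short))
    where
    follow : (∃ λ p → ¬ 2 ≤ total F p) → ∃ λ t → Path R x t × (copyOf t ≡ s j ⊎ copyOf t ≡ s' j)
    follow (zero , light) with twin-survives F R R? covered cross light tag-cross
    ... | t , tw , alive = t , edge x-alive alive (adj-twins x cross x~cross (inj₁ refl) tw) , inj₁ (copy-twin tw)
    follow (suc r , light) with twin-survives F R R? covered (inner r) light (tag-inner r)
                              | twin-survives F R R? covered (far r) light (tag-far r)
    ... | t₁ , tw₁ , alive₁ | t₂ , tw₂ , alive₂ =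
      t₂ , step x-alive (adj-twins x (inner r) (x~inner r) (inj₁ refl) tw₁)
                        (edge alive₁ alive₂ (adj-twins (inner r) (far r) (inner~far r) tw₁ tw₂)) ,
      inj₂ (copy-twin tw₂)

-- If every star meets copy s j, the opposite copy
-- s' j is untouched, and the M+1 paths x — (a+1, j, y⁽ʳ⁾) — (a, s' j, y⁽ʳ⁾) of
-- `Escape` lead into it.  Only their middle twins can be removed, and a star
-- meeting copy s j contains at most one of them, so one path survives.
module Detour {M : ℕ} (a j : Fin 4) (y : Vec (Fin 4) M) where

  open Escape a j y using (s; s'; x; inner; far; x~inner; inner~far)

  -- One path per tail changeAt s y r.
  P : ℕ
  P = suc M

  -- The middle vertices: opposite parity to a, in copy j.
  Candidate : Vertex (suc (suc M)) → Set
  Candidate v = sameParity a (head v) ≡ false × copyOf v ≡ j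

  candidate? : ∀ v → Dec (Candidate v)
  candidate? (b ∷ c ∷ _) = (sameParity a b Bool.≟ false) ×-dec (c ≟ j)

  tag : Vertex (suc (suc M)) → Maybe (Fin P)
  tag v@(b ∷ c ∷ y') with candidate? v
  ... | yes _ = changedCoordinate s y y'
  ... | no _ = nothing

  open Pigeonhole P tag

  tag-candidate : ∀ v → ¬ Candidate v → tag v ≡ nothing
  tag-candidate v@(b ∷ c ∷ y') nc with candidate? v
  ... | yes cv = ⊥-elim (nc cv)
  ... | no _ = refl

  tag-inner : ∀ r → tag (inner r) ≡ just r
  tag-inner r with candidate? (inner r)
  ... | yes _ = changedCoordinate-complete s (shift≢ a) y r
  ... | no nc = ⊥-elim (nc (sameParity-inc a , refl))

  tag-twin : ∀ v → tag (twin v) ≡ tag v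
  tag-twin v@(b ∷ c ∷ y') with candidate? v | candidate? (twin v)
  ... | yes _ | yes _ = refl
  ... | no _ | no _ = refl
  ... | yes (pb , cj) | no nc = ⊥-elim (nc (trans (sameParity-antipode a b) pb , cj))
  ... | no nc | yes (pb , cj) = ⊥-elim (nc (trans (sym (sameParity-antipode a b)) pb , cj))

  open TwinPigeonhole P tag tag-twin

  -- A star meeting copy s j has no candidate centre and at most one candidate leaf.
  -- A candidate centre only reaches copies j and s' j.
  centre-not-candidate : ∀ z u w → IsPiece (star z u w) → Meets (s j) (star z u w) → ¬ Candidate z
  centre-not-candidate z u w (zu , zw) m (pz , cz) = noSlot m
    where
    notThere : ∀ v → Adj _ z v → copyOf v ≢ s j
    notThere v zv e with adj-copy z v zv
    ... | inj₁ same = shift≢ a j (trans (sym e) (trans same cz))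
    ... | inj₂ cross = shift≢shift-inc a j
      (trans (sym e) (trans cross (trans (shift-oppParity a (head z) pz _) (cong s' cz))))
    noSlot : ¬ Meets (s j) (star z u w)
    noSlot (inj₁ e) = shift≢ a j (trans (sym e) cz)
    noSlot (inj₂ (inj₁ e)) = notThere u zu e
    noSlot (inj₂ (inj₂ e)) = notThere w zw e

  -- Two candidate leaves force the centre into copy s j, which has no
  -- neighbours in copy j of a's parity class.
  leaves-not-both : ∀ z u w → IsPiece (star z u w) → Meets (s j) (star z u w) → Candidate u → Candidate w → ⊥
  leaves-not-both z u w (zu , zw) m (pu , cu) (pw , cw) = centreIn m
    where
    pz : sameParity a (head z) ≡ true
    pz with sameParity a (head z) in e | adj-parity a z u zu
    ... | true | _ = refl
    ... | false | flip = ⊥-elim (Bool.not-¬ refl (trans (sym pu) flip))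
    centreIn : ¬ Meets (s j) (star z u w)
    centreIn (inj₂ (inj₁ e)) = shift≢ a j (trans (sym e) cu)
    centreIn (inj₂ (inj₂ e)) = shift≢ a j (trans (sym e) cw)
    centreIn (inj₁ e) with adj-copy z u zu
    ... | inj₁ same = shift≢ a j (trans (sym e) (trans (sym same) cu))
    ... | inj₂ cross = shift-shift≢ a j
      (trans (cong s (sym e)) (trans (sym (shift-sameParity a (head z) pz _)) (trans (sym cross) cu)))

  weight≤1 : ∀ st → IsPiece st → Meets (s j) st → weight st ≤ 1
  weight≤1 (star z u w) piece m =
    ≤-trans (weight≤tagged (star z u w)) (bound (candidate? u) (candidate? w))
    where
    none : ∀ v → ¬ Candidate v → ∑ P (hit v) ≡ 0
    none v nc = ∑-hit-untagged v (tag-candidate v nc)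
    bound : Dec (Candidate u) → Dec (Candidate w) → ∑ P (hit z) + (∑ P (hit u) + (∑ P (hit w) + 0)) ≤ 1
    bound (yes cu) (yes cw) = ⊥-elim (leaves-not-both z u w piece m cu cw)
    bound (no nu) _ rewrite none z (centre-not-candidate z u w piece m) | none u nu =
      subst (_≤ 1) (sym (+-identityʳ _)) (∑-hit w)
    bound (yes _) (no nw) rewrite none z (centre-not-candidate z u w piece m) | none w nw =
      subst (_≤ 1) (sym (+-identityʳ _)) (∑-hit u)

  detour : (R : Vertex (suc (suc M)) → Set) → (∀ v → Dec (R v)) → (F : List (Star (suc (suc M)))) →
           All IsPiece F → All (Meets (s j)) F → length F ≤ suc M → (∀ v → R v → InV F v) →
           (∀ v → copyOf v ≡ s' j → ¬ R v) → ¬ R x → ∃ λ t → Path R x t × copyOf t ≡ s' j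
  detour R R? F pieces meet short covered clean x-alive = follow (light-index F 1 weights small)
    where
    weights : All (λ s → weight s ≤ 1) F
    weights = All.zipWith (λ { {st} (piece , m) → weight≤1 st piece m }) (pieces , meet)
    small : length F * 1 < 2 * suc M
    small = begin-strict
      length F * 1   ≡⟨ *-identityʳ _ ⟩
      length F       ≤⟨ short ⟩
      suc M          <⟨ m<m+n (suc M) (s≤s z≤n) ⟩
      suc M + suc M  ≡⟨ cong (suc M +_) (+-identityʳ (suc M)) ⟨
      2 * suc M      ∎
      where open ≤-Reasoning
    follow : (∃ λ p → ¬ 2 ≤ total F p) → ∃ λ t → Path R x t × copyOf t ≡ s' j
    follow (r , light) with twin-survives F R R? covered (inner r) light (tag-inner r)
    ... | t , tw , alive =
      far r , step x-alive (adj-twins x (inner r) (x~inner r) (inj₁ refl) tw)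
                           (edge alive (clean (far r) refl) (adj-twins (inner r) (far r) (inner~far r) tw (inj₁ refl))) ,
      refl

-- In BH_{M+3}, for each of M+3 distinct tails t the
-- cross edge (0, j, t) — (1, j+1, t), doubled by twins, joins copies j and j+1.
-- A cross edge keeps the tail, and even vertices of copy j have no other
-- neighbours in copy j+1, so these links are separated.
module Link {M : ℕ} (j : Fin 4) where

  P : ℕ
  P = suc (suc (suc M))

  zeros twos : Vec (Fin 4) (suc M)
  zeros = replicate (suc M) zero
  twos = replicate (suc M) (suc (suc zero))

  linkTail : Fin P → Vec (Fin 4) (suc M)
  linkTail zero = twos
  linkTail (suc r) = changeAt inc4 zeros r

  -- The link tails are distinct: twos differ from the others in the head.
  linkTail-injective : ∀ p q → linkTail p ≡ linkTail q → p ≡ q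
  linkTail-injective zero zero _ = refl
  linkTail-injective zero (suc r) e = ⊥-elim (head≢2 r (cong head (sym e)))
    where
    head≢2 : ∀ r → head (changeAt inc4 zeros r) ≢ suc (suc zero)
    head≢2 zero ()
    head≢2 (suc zero) ()
    head≢2 (suc (suc i)) ()
  linkTail-injective (suc r) zero e = sym (linkTail-injective zero (suc r) (sym e))
  linkTail-injective (suc r) (suc r') e = cong suc (changeAt-injective inc4 (shift≢ zero) zeros r r' e)

  -- Even vertices are tagged in copy j, odd vertices in copy j+1, by their tail.
  tagAt : Bool → Fin 4 → Vec (Fin 4) (suc M) → Maybe (Fin P)
  tagAt true c t with c ≟ j
  ... | yes _ = indexOf _≟ⱽ_ linkTail t
  ... | no _ = nothing
  tagAt false c t with c ≟ inc4 j
  ... | yes _ = indexOf _≟ⱽ_ linkTail t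
  ... | no _ = nothing

  tag : Vertex (suc (suc (suc M))) → Maybe (Fin P)
  tag (b ∷ c ∷ t) = tagAt (sameParity zero b) c t

  open Pigeonhole P tag

  tag-twin : ∀ v → tag (twin v) ≡ tag v
  tag-twin (b ∷ c ∷ t) = cong (λ e → tagAt e c t) (sameParity-antipode zero b)

  open TwinPigeonhole P tag tag-twin

  tagAt-even : ∀ c t {p} → tagAt true c t ≡ just p → c ≡ j × indexOf _≟ⱽ_ linkTail t ≡ just p
  tagAt-even c t e with c ≟ j
  ... | yes c≡j = c≡j , e

  tagAt-odd : ∀ t → tagAt false (inc4 j) t ≡ indexOf _≟ⱽ_ linkTail t
  tagAt-odd t with inc4 j ≟ inc4 j
  ... | yes _ = refl
  ... | no ne = ⊥-elim (ne refl)

  tagAt-odd-j : ∀ t → tagAt false j t ≡ nothing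
  tagAt-odd-j t with j ≟ inc4 j
  ... | yes e = ⊥-elim (shift≢ zero j (sym e))
  ... | no _ = refl

  -- A tagged even vertex has its tagged neighbours across the cross edge, with
  -- the same tail.
  agree-from-even : ∀ v v' {p q} → sameParity zero (head v) ≡ true → Adj _ v v' →
                    tag v ≡ just p → tag v' ≡ just q → p ≡ q
  agree-from-even (b ∷ c ∷ t) (b' ∷ c' ∷ t') even adj tv tv'
    rewrite even | sameParity-flip zero b b' (proj₁ adj) | even
    with tagAt-even c t tv | proj₂ (adj-split b c t b' c' t' adj)
  ... | refl , it | inj₂ (c'≡ , refl) rewrite trans c'≡ (shift-sameParity zero b even j) =
    just-injective (trans (sym it) (trans (sym (tagAt-odd t)) tv'))
  ... | refl , it | inj₁ (refl , _) with trans (sym (tagAt-odd-j t')) tv'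
  ...   | ()

  agree : TagsAgree
  agree v v' adj tv tv' with sameParity zero (head v) in e
  ... | true = agree-from-even v v' e adj tv tv'
  ... | false = sym (agree-from-even v' v (trans (adj-parity zero v v' adj) (cong not e)) (adj-sym v v' adj) tv' tv)

  even odd : Fin P → Vertex (suc (suc (suc M)))
  even p = zero ∷ j ∷ linkTail p
  odd p = suc zero ∷ inc4 j ∷ linkTail p

  tag-even : ∀ p → tag (even p) ≡ just p
  tag-even p with j ≟ j
  ... | yes _ = indexOf-complete _≟ⱽ_ linkTail linkTail-injective p
  ... | no ne = ⊥-elim (ne refl)

  tag-odd : ∀ p → tag (odd p) ≡ just p
  tag-odd p = trans (tagAt-odd (linkTail p)) (indexOf-complete _≟ⱽ_ linkTail linkTail-injective p)

  link : (R : Vertex (suc (suc (suc M))) → Set) → (∀ v → Dec (R v)) → (F : List (Star (suc (suc (suc M))))) →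
         All IsPiece F → length F ≤ suc (suc M) → (∀ v → R v → InV F v) →
         ∃ λ u → ∃ λ v → ¬ R u × ¬ R v × Adj _ u v × copyOf u ≡ j × copyOf v ≡ inc4 j
  link R R? F pieces short covered =
    follow (light-index F 2 (All.map (λ {s} → weight≤2 agree s) pieces) (k*2<2*[1+N] _ _ short))
    where
    follow : (∃ λ p → ¬ 2 ≤ total F p) →
             ∃ λ u → ∃ λ v → ¬ R u × ¬ R v × Adj _ u v × copyOf u ≡ j × copyOf v ≡ inc4 j
    follow (p , light) with twin-survives F R R? covered (even p) light (tag-even p)
                          | twin-survives F R R? covered (odd p) light (tag-odd p)
    ... | u , tu , u-alive | v , tv , v-alive =
      u , v , u-alive , v-alive , adj-twins (even p) (odd p) (inj₁ refl , inj₂ (zero , refl)) tu tv ,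
      copy-twin tu , copy-twin tv

Connected : ∀ {n} → (Vertex n → Set) → Set
Connected R = ∀ u v → ¬ R u → ¬ R v → Path R u v

SurvivingEdge : ∀ {n} → (Vertex n → Set) → Set
SurvivingEdge {n} R = ∃ λ u → ∃ λ v → ¬ R u × ¬ R v × Adj n u v

Robust : ℕ → Set₁
Robust M = ∀ (F : List (Star (suc M))) → All IsPiece F → length F ≤ M →
           ∀ (R : Vertex (suc M) → Set) → (∀ v → Dec (R v)) → (∀ v → R v → InV F v) →
           Connected R × SurvivingEdge R

-- BH_1 is the 4-cycle, and nothing is removed.
robust-base : Robust 0
robust-base [] [] z≤n R R? covered = connected , (zero ∷ [] , suc zero ∷ [] , alive _ , alive _ , inj₁ refl , inj₁ refl)
  where
  alive : ∀ v → ¬ R v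
  alive v r with covered v r
  ... | ()
  connected : Connected R
  connected (a ∷ []) (b ∷ []) _ _ with classify₄ a b
  ... | inj₁ refl = here (alive _)
  ... | inj₂ (inj₁ refl) = edge (alive _) (alive _) (inj₁ refl , inj₁ refl)
  ... | inj₂ (inj₂ (inj₁ refl)) = edge (alive _) (alive _) (inj₂ refl , inj₁ refl)
  ... | inj₂ (inj₂ (inj₂ refl)) = step (alive _) (inj₁ refl , inj₁ refl) (edge (alive _) (alive _) (inj₁ refl , inj₁ refl))

open Restriction

untouched-alive : ∀ {M} (F : List (Star (suc (suc M)))) (R : Vertex (suc (suc M)) → Set) →
                  (∀ v → R v → InV F v) → ∀ j → restrictAll j F ≡ [] → ∀ v → copyOf v ≡ j → ¬ R v
untouched-alive F R covered j empty v cv r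
  with subst (λ G → InV G (proj v)) empty
         (restrictAll-covers j F (proj v) (subst (InV F) (sym (emb-proj j v cv)) (covered v r)))
... | ()

-- Two adjacent copies met by at most M stars each are joined by a surviving
-- edge: for M = 0 both are untouched, otherwise use `Link`.
linkAt : ∀ M (F : List (Star (suc (suc M)))) → All IsPiece F → length F ≤ suc M →
         (R : Vertex (suc (suc M)) → Set) → (∀ v → Dec (R v)) → (∀ v → R v → InV F v) →
         ∀ j → length (restrictAll j F) ≤ M → length (restrictAll (inc4 j) F) ≤ M →
         ∃ λ u → ∃ λ v → ¬ R u × ¬ R v × Adj _ u v × copyOf u ≡ j × copyOf v ≡ inc4 j
linkAt zero F pieces short R R? covered j gj gj+1 =
  zero ∷ j ∷ [] , suc zero ∷ inc4 j ∷ [] ,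
  untouched-alive F R covered j (empty _ gj) _ refl ,
  untouched-alive F R covered (inc4 j) (empty _ gj+1) _ refl ,
  (inj₁ refl , inj₂ (zero , refl)) , refl , refl
  where
  empty : ∀ {A : Set} (L : List A) → length L ≤ 0 → L ≡ []
  empty [] _ = refl
linkAt (suc M) F pieces short R R? covered j _ _ = Link.link j R R? F pieces short covered

module Step (M : ℕ) (IH : Robust M) (F : List (Star (suc (suc M)))) (pieces : All IsPiece F)
            (short : length F ≤ suc M) (R : Vertex (suc (suc M)) → Set) (R? : ∀ v → Dec (R v))
            (covered : ∀ v → R v → InV F v) where

  -- A copy is good if at most M stars meet it; then it is robust by induction.
  Good : Fin 4 → Set
  Good j = length (restrictAll j F) ≤ M

  good? : ∀ j → Dec (Good j)
  good? j = length (restrictAll j F) ≤? M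

  copy-robust : ∀ j → Good j → Connected (R ∘ emb j) × SurvivingEdge (R ∘ emb j)
  copy-robust j g = IH (restrictAll j F) (restrictAll-pieces j F pieces) g (R ∘ emb j) (R? ∘ emb j)
                       (λ w r → restrictAll-covers j F w (covered _ r))

  bad-met : ∀ j → ¬ Good j → All (Meets j) F
  bad-met j bad = restrictAll-full j F (≤-trans short (≰⇒> bad))

  bad-opposite-empty : ∀ j → ¬ Good j → restrictAll (antipode j) F ≡ []
  bad-opposite-empty j bad =
    restrictAll-empty (antipode j) F (All.zipWith (λ { {s} (piece , m) → meets-not-antipodal j s piece m }) (pieces , bad-met j bad))

  bad-opposite-good : ∀ j → ¬ Good j → Good (antipode j)
  bad-opposite-good j bad rewrite bad-opposite-empty j bad = z≤n

  opposite-alive : ∀ j → ¬ Good j → ∀ v → copyOf v ≡ antipode j → ¬ R v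
  opposite-alive j bad = untouched-alive F R covered (antipode j) (bad-opposite-empty j bad)

  within : ∀ j → Good j → ∀ u v → ¬ R u → ¬ R v → copyOf u ≡ j → copyOf v ≡ j → Path R u v
  within j g u v au av cu cv =
    subst₂ (Path R) (emb-proj j u cu) (emb-proj j v cv)
      (path-emb j R (proj₁ (copy-robust j g) (proj u) (proj v)
        (λ r → au (subst R (emb-proj j u cu) r)) (λ r → av (subst R (emb-proj j v cv) r))))

  alive-in : ∀ j → Good j → ∃ λ t → ¬ R t × copyOf t ≡ j
  alive-in j g with proj₂ (copy-robust j g)
  ... | t@(_ ∷ _) , _ , alive , _ = emb j t , alive , refl

  edge-in : ∀ j → Good j → SurvivingEdge R
  edge-in j g with proj₂ (copy-robust j g)
  ... | u , v , au , av , uv = emb j u , emb j v , au , av , adj-emb j u v uv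

  forward : ∀ j → Good j → Good (inc4 j) → ∀ u v → ¬ R u → ¬ R v → copyOf u ≡ j → copyOf v ≡ inc4 j → Path R u v
  forward j gj gj+1 u v au av cu cv with linkAt M F pieces short R R? covered j gj gj+1
  ... | lu , lv , alu , alv , e , clu , clv =
    within j gj u lu au alu cu clu ++ᴾ step alu e (within (inc4 j) gj+1 lv v alv av clv cv)

  adjacent : ∀ j k → Neighbour₄ j k → Good j → Good k →
             ∀ u v → ¬ R u → ¬ R v → copyOf u ≡ j → copyOf v ≡ k → Path R u v
  adjacent j k (inj₁ refl) gj gk u v au av cu cv = forward j gj gk u v au av cu cv
  adjacent j k (inj₂ refl) gj gk u v au av cu cv =
    path-sym (forward k gk (subst Good (sym (inc-dec j)) gj) v u av au cv (trans cu (sym (inc-dec j))))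

  -- Any two surviving vertices in good copies are connected: antipodal good
  -- copies are joined through a good copy adjacent to both.
  between-good : ∀ j k → Good j → Good k → ∀ u v → ¬ R u → ¬ R v → copyOf u ≡ j → copyOf v ≡ k → Path R u v
  between-good j k gj gk u v au av cu cv with classify₄ j k
  ... | inj₁ refl = within j gj u v au av cu cv
  ... | inj₂ (inj₁ refl) = adjacent j k (inj₁ refl) gj gk u v au av cu cv
  ... | inj₂ (inj₂ (inj₁ refl)) = adjacent j k (inj₂ refl) gj gk u v au av cu cv
  ... | inj₂ (inj₂ (inj₂ refl)) = viaMiddle (middle (good? (inc4 j)))
    where
    Middle : Set
    Middle = ∃ λ m → Neighbour₄ j m × Neighbour₄ m (antipode j) × Good m
    middle : Dec (Good (inc4 j)) → Middle
    middle (yes g) = inc4 j , inj₁ refl , inj₁ refl , g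
    middle (no bad) = dec4 j , inj₂ refl , inj₂ (sym (dec-dec j)) , subst Good (antipode-inc j) (bad-opposite-good (inc4 j) bad)
    viaMiddle : Middle → Path R u v
    viaMiddle (m , jm , mk , gm) with alive-in m gm
    ... | w , aw , cw = adjacent j m jm gj gm u w au aw cu cw ++ᴾ adjacent m (antipode j) mk gm gk w v aw av cw cv

  -- Every surviving vertex x = (a, j, y) reaches a good copy: if both copies
  -- j ± 1 are good use `Escape`; if copy s j is bad use `Detour` into the
  -- untouched copy s' j; if copy s' j is bad, the cross neighbour in s j survives.
  to-good : ∀ x → ¬ R x → ∃ λ t → Path R x t × ¬ R t × Good (copyOf t)
  to-good x@(a ∷ j ∷ y) ax with good? (shift a j) | good? (shift (inc4 a) j)
  ... | no bad | _ with Detour.detour a j y R R? F pieces (bad-met (shift a j) bad) short covered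
                          (λ v cv → opposite-alive (shift a j) bad v (trans cv (sym (antipode-shift a j)))) ax
  ...   | t , path , ct =
    t , path , path-end path , subst Good (trans (antipode-shift a j) (sym ct)) (bad-opposite-good (shift a j) bad)
  to-good x@(a ∷ j ∷ y) ax | yes gs | no bad' =
    inc4 a ∷ shift a j ∷ y , edge ax alive (inj₁ refl , inj₂ (zero , refl)) , alive , gs
    where
    alive : ¬ R (inc4 a ∷ shift a j ∷ y)
    alive = opposite-alive (shift (inc4 a) j) bad' _ (sym (antipode-shift-inc a j))
  to-good x@(a ∷ j ∷ y) ax | yes gs | yes gs' with Escape.escape a j y R R? F pieces short covered ax
  ...   | t , path , inj₁ ct = t , path , path-end path , subst Good (sym ct) gs
  ...   | t , path , inj₂ ct = t , path , path-end path , subst Good (sym ct) gs'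

  connected : Connected R
  connected u v au av with to-good u au | to-good v av
  ... | tu , pu , atu , gu | tv , pv , atv , gv =
    pu ++ᴾ (between-good (copyOf tu) (copyOf tv) gu gv tu tv atu atv refl refl ++ᴾ path-sym pv)

  -- Copy 0 or its antipode is good, and contains a surviving edge.
  surviving-edge : SurvivingEdge R
  surviving-edge with good? zero
  ... | yes g = edge-in zero g
  ... | no bad = edge-in (antipode zero) (bad-opposite-good zero bad)

robust : ∀ M → Robust M
robust zero = robust-base
robust (suc M) F pieces short R R? covered =
  Step.connected M (robust M) F pieces short R R? covered , Step.surviving-edge M (robust M) F pieces short R R? covered

toReach : ∀ {n} {F : List (Star n)} {x y} → Path (InV F) x y → Reach F x y
toReach (here a) = here a
toReach (step a e p) = step a e (toReach p)

inV? : ∀ {n} (F : List (Star n)) v → Dec (InV F v)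
inV? F v = Any.any? (λ s → (v ≟ⱽ Star.centre s) ⊎-dec (v ≟ⱽ Star.leaf1 s) ⊎-dec (v ≟ⱽ Star.leaf2 s)) F

k12-piece : ∀ {n} (s : Star n) → IsK12 n s → IsPiece s
k12-piece (star c u w) (cu , cw , _) = cu , cw

-- By `robust (M+1)`, removing at most M+1 stars leaves BH_{M+2} connected and
-- non-trivial, so it is not a cut.
cut-size : ∀ M (F : List (Star (suc (suc M)))) → IsK12StructureCut (suc (suc M)) F → suc (suc M) ≤ length F
cut-size M F (k12 , separates) with suc (suc M) ≤? length F
... | yes big = big
... | no small with robust (suc M) F (All.map (λ {s} → k12-piece s) k12) (≤-pred (≰⇒> small))
                          (InV F) (inV? F) (λ v r → r)
...   | connected , (u , v , au , av , uv) with separates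
...     | inj₁ (x , y , ax , ay , unreachable) = ⊥-elim (unreachable (toReach (connected x y ax ay)))
...     | inj₂ trivial = ⊥-elim (adj-irrefl v (subst (λ t → Adj _ t v) (trivial u v au av) uv))

module Isolation (m : ℕ) where

  n : ℕ
  n = suc (suc m)

  zeros : Vec (Fin 4) (suc m)
  zeros = replicate (suc m) zero

  neighbourTail : Fin n → Vec (Fin 4) (suc m)
  neighbourTail = changeAt inc4 zeros

  starAt : Fin n → Star n
  starAt r = star (suc (suc zero) ∷ neighbourTail r) (suc zero ∷ neighbourTail r) (suc (suc (suc zero)) ∷ neighbourTail r)

  F : List (Star n)
  F = tabulate starAt

  k12 : All (IsK12 n) F
  k12 = AllProps.tabulate⁺ {f = starAt} (λ r → (inj₂ refl , inj₁ refl) , (inj₁ refl , inj₁ refl) , (λ ()) , (λ ()) , (λ ()))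

  distinct : AllPairs (λ s t → ¬ SameStar s t) F
  distinct = AllPairs.tabulate⁺ notSame
    where
    notSame : ∀ {r r'} → r ≢ r' → ¬ SameStar (starAt r) (starAt r')
    notSame {r} {r'} r≢r' (same , _) = r≢r' (changeAt-injective inc4 (shift≢ zero) zeros r r' (cong tail same))

  size : length F ≡ n
  size = length-tabulate starAt

  o far : Vertex n
  o = zero ∷ zeros
  far = zero ∷ (suc (suc zero) ∷ replicate m zero)

  level0-outside : ∀ t → ¬ InV F (zero ∷ t)
  level0-outside t m with AnyProps.tabulate⁻ {f = starAt} m
  ... | r , inj₁ ()
  ... | r , inj₂ (inj₁ ())
  ... | r , inj₂ (inj₂ ())

  neighbour-inside : ∀ y → Adj n o y → InV F y
  neighbour-inside (._ ∷ ._) (inj₁ refl , inj₁ refl) = AnyProps.tabulate⁺ {f = starAt} zero (inj₂ (inj₁ refl))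
  neighbour-inside (._ ∷ ._) (inj₂ refl , inj₁ refl) = AnyProps.tabulate⁺ {f = starAt} zero (inj₂ (inj₂ refl))
  neighbour-inside (._ ∷ ._) (inj₁ refl , inj₂ (i , refl)) = AnyProps.tabulate⁺ {f = starAt} (suc i) (inj₂ (inj₁ refl))
  neighbour-inside (._ ∷ ._) (inj₂ refl , inj₂ (i , refl)) = AnyProps.tabulate⁺ {f = starAt} (suc i) (inj₂ (inj₂ refl))

  isolated : ¬ Reach F o far
  isolated (step {y = y} _ oy r) = reach-start r (neighbour-inside y oy)
    where
    reach-start : ∀ {x z} → Reach F x z → ¬ InV F x
    reach-start (here a) = a
    reach-start (step a _ _) = a

  cut : IsK12StructureCut n F
  cut = k12 , inj₁ (o , far , level0-outside _ , level0-outside _ , isolated)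

lemma12 : (n : ℕ) → 2 ≤ n → KappaK12 n n
lemma12 (suc (suc m)) (s≤s (s≤s z≤n)) =
  (F , cut , distinct , size) , (λ G cutG _ → cut-size m G cutG)
  where open Isolation m
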